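{- Let $f:\mathbb{F}_2^n\to\{ -1,1\}$ be a Boolean function. Then for every pair of distinct $\alpha,\beta\in\mathcal{S}$ there exists an unordered pair $\{\gamma,\delta\}\neq\{\alpha,\beta\}$ of distinct elements of $\mathcal{S}$ with $\alpha+\beta=\gamma+\delta$. In other words, $|O_{\alpha+\beta}|\ge2$.
   Context: For $\alpha\in\mathbb{F}_2^n$ let $\chi_\alpha(x)=(-1)^{\sum_i\alpha_ix_i}$; every $f:\mathbb{F}_2^n\to\mathbb{R}$ is uniquely $f=\sum_\alpha\widehat f(\alpha)\chi_\alpha$. The Fourier support is $\mathcal{S}=\{\alpha:\widehat f(\alpha)\ne0\}$. For $\gamma\in\mathbb{F}_2^n$, $O_\gamma$ is the set of unordered pairs of distinct elements of $\mathcal{S}$ summing to $\gamma$. -}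

module Defs where

open import Data.Bool using (Bool; true; false; _xor_; _∧_; if_then_else_)
open import Data.Vec using (Vec; []; _∷_; zipWith; foldr)
open import Data.List using (List; []; _∷_; map; _++_)
open import Data.Nat using (ℕ; zero; suc)
open import Data.Integer using (ℤ; +_; -_; _*_; _+_)
open import Relation.Binary.PropositionalEquality using (_≡_)
open import Relation.Nullary using (¬_)

𝔽₂^ : ℕ → Set
𝔽₂^ n = Vec Bool n

allVecs : (n : ℕ) → List (𝔽₂^ n)
allVecs zero = [] ∷ []
allVecs (suc n) = map (false ∷_) (allVecs n) ++ map (true ∷_) (allVecs n)

_⊕_ : ∀ {n} → 𝔽₂^ n → 𝔽₂^ n → 𝔽₂^ n
_⊕_ = zipWith _xor_

dot : ∀ {n} → 𝔽₂^ n → 𝔽₂^ n → Bool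
dot α x = foldr _ _xor_ false (zipWith _∧_ α x)

χ : ∀ {n} → 𝔽₂^ n → 𝔽₂^ n → ℤ
χ α x = if dot α x then - (+ 1) else + 1

sumℤ : List ℤ → ℤ
sumℤ [] = + 0
sumℤ (z ∷ zs) = z + sumℤ zs

-- 2ⁿ · f̂(α) = ∑ₓ f(x) χ_α(x)   (f̂(α) = 2⁻ⁿ ∑ₓ f(x) χ_α(x))
scaledFourier : ∀ {n} → (𝔽₂^ n → ℤ) → 𝔽₂^ n → ℤ
scaledFourier {n} f α = sumℤ (map (λ x → f x * χ α x) (allVecs n))

InSupport : ∀ {n} → (𝔽₂^ n → ℤ) → 𝔽₂^ n → Set
InSupport f α = ¬ (scaledFourier f α ≡ + 0)

IsBoolean : ∀ {n} → (𝔽₂^ n → ℤ) → Set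
IsBoolean {n} f = ∀ (x : 𝔽₂^ n) → (f x ≡ + 1) Data.Sum.⊎ (f x ≡ - (+ 1))
  where import Data.Sum

-- Write F = 2ⁿ f̂. Expanding F and using orthogonality of the characters, the autocorrelation
-- ∑_z F(z) F(z + γ) equals 2ⁿ ∑_x f(x)² χ_γ(x); since f² = 1 this is 2ⁿ ∑_x χ_γ(x) = 0 for γ ≠ 0.
-- For γ = α + β the terms z = α and z = β both equal F(α) F(β) ≠ 0, so some other z gives a
-- nonzero term, and {z, z + γ} is a second pair in 𝒮 with sum γ.
module Submission where

open import Defs
open import Data.Nat using (ℕ)
open import Data.Integer using (ℤ)
open import Data.Product using (Σ; _×_; ∃-syntax)
open import Data.Sum using (_⊎_)
open import Relation.Binary.PropositionalEquality using (_≡_; _≢_)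
open import Relation.Nullary using (¬_)

open import Data.Nat using (suc)
open import Data.Bool using (Bool; true; false; _xor_; if_then_else_) renaming (_≟_ to _≟ᵇ_)
open import Data.Bool.Properties using (xor-assoc; xor-comm; xor-identityˡ; xor-identityʳ; xor-same; ∧-comm)
open import Data.Vec using ([]; _∷_; replicate; tail)
open import Data.Vec.Properties using (≡-dec; zipWith-assoc; zipWith-comm; zipWith-identityˡ; zipWith-identityʳ)
open import Data.List using (List; []; _∷_; map; _++_)
open import Data.List.Membership.Propositional using (_∈_; lose)
open import Data.List.Membership.Propositional.Properties using (∈-map⁺; ∈-++⁺ˡ; ∈-++⁺ʳ)
open import Data.List.Relation.Unary.Any using (here; any?; satisfied)
open import Data.Integer using (+_; -_; _*_; _+_)
open import Data.Integer.Properties using (+-assoc; +-identityˡ; +-identityʳ; *-identityˡ; *-zeroʳ; *-distribˡ-+; *-distribʳ-+; *-comm; i*j≡0⇒i≡0∨j≡0) renaming (_≟_ to _≟ℤ_)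
open import Data.Integer.Tactic.RingSolver using (solve-∀)
open import Data.Product using (_,_)
open import Data.Sum using (inj₁; inj₂; [_,_])
open import Function using (_∘_; id)
open import Relation.Nullary using (Dec; yes; no; does; ¬?; contradiction)
open import Relation.Nullary.Decidable using (dec-true; dec-false; map′; _×-dec_; decidable-stable)
open import Relation.Binary.PropositionalEquality using (refl; sym; trans; cong; cong₂; module ≡-Reasoning)

open ≡-Reasoning

private
  variable
    A B : Set

∑ : List A → (A → ℤ) → ℤ
∑ xs g = sumℤ (map g xs)

syntax ∑ xs (λ x → e) = ∑[ x ∈ xs ] e

∑-cong : (xs : List A) {g h : A → ℤ} → (∀ x → g x ≡ h x) → ∑ xs g ≡ ∑ xs h
∑-cong []       g≡h = refl
∑-cong (x ∷ xs) g≡h = cong₂ _+_ (g≡h x) (∑-cong xs g≡h)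

∑-zero : (xs : List A) {g : A → ℤ} → (∀ x → g x ≡ + 0) → ∑ xs g ≡ + 0
∑-zero []       g≡0 = refl
∑-zero (x ∷ xs) g≡0 = cong₂ _+_ (g≡0 x) (∑-zero xs g≡0)

∑-+ : (xs : List A) (g h : A → ℤ) → ∑[ x ∈ xs ] (g x + h x) ≡ ∑ xs g + ∑ xs h
∑-+ []       g h = refl
∑-+ (x ∷ xs) g h = trans (cong (_+_ (g x + h x)) (∑-+ xs g h)) (interchange (g x) (h x) _ _)
  where
  interchange : ∀ (a b c d : ℤ) → (a + b) + (c + d) ≡ (a + c) + (b + d)
  interchange = solve-∀

∑-*ˡ : (xs : List A) (c : ℤ) (g : A → ℤ) → ∑[ x ∈ xs ] (c * g x) ≡ c * ∑ xs g
∑-*ˡ []       c g = sym (*-zeroʳ c)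
∑-*ˡ (x ∷ xs) c g = trans (cong (_+_ (c * g x)) (∑-*ˡ xs c g)) (sym (*-distribˡ-+ c (g x) (∑ xs g)))

∑-*ʳ : (xs : List A) (c : ℤ) (g : A → ℤ) → ∑[ x ∈ xs ] (g x * c) ≡ ∑ xs g * c
∑-*ʳ []       c g = refl
∑-*ʳ (x ∷ xs) c g = trans (cong (_+_ (g x * c)) (∑-*ʳ xs c g)) (sym (*-distribʳ-+ c (g x) (∑ xs g)))

∑-++ : (xs ys : List A) (g : A → ℤ) → ∑ (xs ++ ys) g ≡ ∑ xs g + ∑ ys g
∑-++ []       ys g = sym (+-identityˡ (∑ ys g))
∑-++ (x ∷ xs) ys g = trans (cong (_+_ (g x)) (∑-++ xs ys g)) (sym (+-assoc (g x) _ _))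

∑-map : (xs : List A) (k : A → B) (g : B → ℤ) → ∑ (map k xs) g ≡ ∑[ x ∈ xs ] g (k x)
∑-map []       k g = refl
∑-map (x ∷ xs) k g = cong (_+_ (g (k x))) (∑-map xs k g)

∑-*-∑ : (xs : List A) (ys : List B) (g : A → ℤ) (h : B → ℤ) →
        ∑ xs g * ∑ ys h ≡ ∑[ x ∈ xs ] ∑[ y ∈ ys ] (g x * h y)
∑-*-∑ xs ys g h = trans (sym (∑-*ʳ xs (∑ ys h) g)) (∑-cong xs (λ x → sym (∑-*ˡ ys (g x) h)))

∑-comm : (xs : List A) (ys : List B) (h : A → B → ℤ) →
         ∑[ x ∈ xs ] ∑[ y ∈ ys ] h x y ≡ ∑[ y ∈ ys ] ∑[ x ∈ xs ] h x y
∑-comm []       ys h = sym (∑-zero ys (λ _ → refl))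
∑-comm (x ∷ xs) ys h = trans (cong (_+_ (∑ ys (h x))) (∑-comm xs ys h)) (sym (∑-+ ys (h x) _))

private
  variable
    n : ℕ

allVecs-complete : (x : 𝔽₂^ n) → x ∈ allVecs n
allVecs-complete []          = here refl
allVecs-complete (false ∷ x) = ∈-++⁺ˡ (∈-map⁺ (false ∷_) (allVecs-complete x))
allVecs-complete (true ∷ x)  = ∈-++⁺ʳ _ (∈-map⁺ (true ∷_) (allVecs-complete x))

∃?-𝔽₂^ : {P : 𝔽₂^ n → Set} → (∀ x → Dec (P x)) → Dec (∃[ x ] P x)
∃?-𝔽₂^ {n} P? = map′ satisfied (λ (x , px) → lose (allVecs-complete x) px) (any? P? (allVecs n))

∑-allVecs-suc : (g : 𝔽₂^ (suc n) → ℤ) →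
                ∑ (allVecs (suc n)) g ≡ ∑[ x ∈ allVecs n ] g (false ∷ x) + ∑[ x ∈ allVecs n ] g (true ∷ x)
∑-allVecs-suc {n} g = trans (∑-++ (map (false ∷_) (allVecs n)) _ g)
                            (cong₂ _+_ (∑-map (allVecs n) _ g) (∑-map (allVecs n) _ g))

∑-concentrated : {g : 𝔽₂^ n → ℤ} (a : 𝔽₂^ n) → (∀ x → x ≢ a → g x ≡ + 0) → ∑ (allVecs n) g ≡ g a
∑-concentrated {g = g} [] _ = +-identityʳ (g [])
∑-concentrated {suc n} {g} (false ∷ a) vanish = begin
  ∑ (allVecs (suc n)) g
    ≡⟨ ∑-allVecs-suc g ⟩
  ∑[ x ∈ allVecs n ] g (false ∷ x) + ∑[ x ∈ allVecs n ] g (true ∷ x)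
    ≡⟨ cong₂ _+_ (∑-concentrated a (λ x x≢a → vanish _ (x≢a ∘ cong tail)))
                 (∑-zero (allVecs n) (λ x → vanish _ (λ ()))) ⟩
  g (false ∷ a) + + 0
    ≡⟨ +-identityʳ _ ⟩
  g (false ∷ a) ∎
∑-concentrated {suc n} {g} (true ∷ a) vanish = begin
  ∑ (allVecs (suc n)) g
    ≡⟨ ∑-allVecs-suc g ⟩
  ∑[ x ∈ allVecs n ] g (false ∷ x) + ∑[ x ∈ allVecs n ] g (true ∷ x)
    ≡⟨ cong₂ _+_ (∑-zero (allVecs n) (λ x → vanish _ (λ ())))
                 (∑-concentrated a (λ x x≢a → vanish _ (x≢a ∘ cong tail))) ⟩
  + 0 + g (true ∷ a)
    ≡⟨ +-identityˡ _ ⟩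
  g (true ∷ a) ∎

_≟ᵛ_ : (x y : 𝔽₂^ n) → Dec (x ≡ y)
_≟ᵛ_ = ≡-dec _≟ᵇ_

∑-concentrated₂ : {g : 𝔽₂^ n → ℤ} {a b : 𝔽₂^ n} → a ≢ b → (∀ x → x ≢ a → x ≢ b → g x ≡ + 0) →
                  ∑ (allVecs n) g ≡ g a + g b
∑-concentrated₂ {n} {g} {a} {b} a≢b vanish = begin
  ∑ (allVecs n) g                     ≡⟨ ∑-cong (allVecs n) split ⟩
  ∑[ x ∈ allVecs n ] (gₐ x + gᵇ x)    ≡⟨ ∑-+ (allVecs n) gₐ gᵇ ⟩
  ∑ (allVecs n) gₐ + ∑ (allVecs n) gᵇ ≡⟨ cong₂ _+_ (∑-concentrated a gₐ-vanish) (∑-concentrated b gᵇ-vanish) ⟩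
  gₐ a + gᵇ b                         ≡⟨ cong₂ _+_ gₐ-at-a gᵇ-at-b ⟩
  g a + g b ∎
  where
  gₐ gᵇ : 𝔽₂^ n → ℤ
  gₐ x = if does (x ≟ᵛ a) then g x else + 0
  gᵇ x = if does (x ≟ᵛ a) then + 0 else g x

  split : ∀ x → g x ≡ gₐ x + gᵇ x
  split x with x ≟ᵛ a
  ... | yes _ = sym (+-identityʳ (g x))
  ... | no  _ = sym (+-identityˡ (g x))

  gₐ-at-a : gₐ a ≡ g a
  gₐ-at-a rewrite dec-true (a ≟ᵛ a) refl = refl

  gᵇ-at-b : gᵇ b ≡ g b
  gᵇ-at-b rewrite dec-false (b ≟ᵛ a) (a≢b ∘ sym) = refl

  gₐ-vanish : ∀ x → x ≢ a → gₐ x ≡ + 0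
  gₐ-vanish x x≢a rewrite dec-false (x ≟ᵛ a) x≢a = refl

  gᵇ-vanish : ∀ x → x ≢ b → gᵇ x ≡ + 0
  gᵇ-vanish x x≢b with x ≟ᵛ a
  ... | yes _   = refl
  ... | no  x≢a = vanish x x≢a x≢b

𝟘 : (n : ℕ) → 𝔽₂^ n
𝟘 n = replicate n false

⊕-comm : (x y : 𝔽₂^ n) → x ⊕ y ≡ y ⊕ x
⊕-comm = zipWith-comm xor-comm

⊕-self : (x : 𝔽₂^ n) → x ⊕ x ≡ 𝟘 n
⊕-self []      = refl
⊕-self (b ∷ x) = cong₂ _∷_ (xor-same b) (⊕-self x)

⊕-cancelˡ : (x y : 𝔽₂^ n) → x ⊕ (x ⊕ y) ≡ y
⊕-cancelˡ {n} x y = begin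
  x ⊕ (x ⊕ y) ≡⟨ sym (zipWith-assoc xor-assoc x x y) ⟩
  (x ⊕ x) ⊕ y ≡⟨ cong (_⊕ y) (⊕-self x) ⟩
  𝟘 n ⊕ y     ≡⟨ zipWith-identityˡ xor-identityˡ y ⟩
  y ∎

⊕-cancelʳ : (x y : 𝔽₂^ n) → y ⊕ (x ⊕ y) ≡ x
⊕-cancelʳ x y = trans (cong (y ⊕_) (⊕-comm x y)) (⊕-cancelˡ y x)

⊕≡𝟘⇒≡ : (x y : 𝔽₂^ n) → x ⊕ y ≡ 𝟘 n → x ≡ y
⊕≡𝟘⇒≡ x y x⊕y≡𝟘 = begin
  x           ≡⟨ sym (zipWith-identityʳ xor-identityʳ x) ⟩
  x ⊕ 𝟘 _     ≡⟨ cong (x ⊕_) (sym x⊕y≡𝟘) ⟩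
  x ⊕ (x ⊕ y) ≡⟨ ⊕-cancelˡ x y ⟩
  y ∎

⊕-fixed⇒𝟘 : (x y : 𝔽₂^ n) → x ≡ x ⊕ y → y ≡ 𝟘 n
⊕-fixed⇒𝟘 x y x≡x⊕y = begin
  y           ≡⟨ sym (⊕-cancelˡ x y) ⟩
  x ⊕ (x ⊕ y) ≡⟨ cong (x ⊕_) (sym x≡x⊕y) ⟩
  x ⊕ x       ≡⟨ ⊕-self x ⟩
  𝟘 _ ∎

sign : Bool → ℤ
sign b = if b then - (+ 1) else + 1

sign-xor : ∀ a b → sign (a xor b) ≡ sign a * sign b
sign-xor false false = refl
sign-xor false true  = refl
sign-xor true  false = refl
sign-xor true  true  = refl

sign-square : ∀ b → sign b * sign b ≡ + 1
sign-square false = refl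
sign-square true  = refl

dot-comm : (x y : 𝔽₂^ n) → dot x y ≡ dot y x
dot-comm []      []      = refl
dot-comm (b ∷ x) (c ∷ y) = cong₂ _xor_ (∧-comm b c) (dot-comm x y)

χ-comm : (x y : 𝔽₂^ n) → χ x y ≡ χ y x
χ-comm x y = cong sign (dot-comm x y)

χ-⊕ʳ : (z x y : 𝔽₂^ n) → χ z (x ⊕ y) ≡ χ z x * χ z y
χ-⊕ʳ []          []      []      = refl
χ-⊕ʳ (false ∷ z) (_ ∷ x) (_ ∷ y) = χ-⊕ʳ z x y
χ-⊕ʳ (true ∷ z)  (c ∷ x) (d ∷ y) = begin
  sign ((c xor d) xor dot z (x ⊕ y))  ≡⟨ sign-xor (c xor d) _ ⟩
  sign (c xor d) * χ z (x ⊕ y)        ≡⟨ cong₂ _*_ (sign-xor c d) (χ-⊕ʳ z x y) ⟩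
  (sign c * sign d) * (χ z x * χ z y) ≡⟨ interchange (sign c) (sign d) (χ z x) (χ z y) ⟩
  (sign c * χ z x) * (sign d * χ z y) ≡⟨ sym (cong₂ _*_ (sign-xor c _) (sign-xor d _)) ⟩
  χ (true ∷ z) (c ∷ x) * χ (true ∷ z) (d ∷ y) ∎
  where
  interchange : ∀ (a b c d : ℤ) → (a * b) * (c * d) ≡ (a * c) * (b * d)
  interchange = solve-∀

χ-⊕ˡ : (x y z : 𝔽₂^ n) → χ (x ⊕ y) z ≡ χ x z * χ y z
χ-⊕ˡ x y z = trans (χ-comm (x ⊕ y) z) (trans (χ-⊕ʳ z x y) (cong₂ _*_ (χ-comm z x) (χ-comm z y)))

∑-χ : (γ : 𝔽₂^ n) → γ ≢ 𝟘 n → ∑[ x ∈ allVecs n ] χ γ x ≡ + 0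
∑-χ []                  γ≢𝟘 = contradiction refl γ≢𝟘
∑-χ {suc n} (false ∷ γ) γ≢𝟘 = trans (∑-allVecs-suc (χ (false ∷ γ))) (cong₂ _+_ ih ih)
  where
  ih : ∑ (allVecs n) (χ γ) ≡ + 0
  ih = ∑-χ γ (γ≢𝟘 ∘ cong (false ∷_))
∑-χ {suc n} (true ∷ γ)  _   = begin
  ∑ (allVecs (suc n)) (χ (true ∷ γ))
    ≡⟨ ∑-allVecs-suc (χ (true ∷ γ)) ⟩
  ∑ (allVecs n) (χ γ) + ∑[ x ∈ allVecs n ] sign (true xor dot γ x)
    ≡⟨ cong (_+_ (∑ (allVecs n) (χ γ))) (trans (∑-cong (allVecs n) (λ x → sign-xor true (dot γ x)))
                                               (∑-*ˡ (allVecs n) (- + 1) (χ γ))) ⟩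
  ∑ (allVecs n) (χ γ) + - + 1 * ∑ (allVecs n) (χ γ)
    ≡⟨ cancel (∑ (allVecs n) (χ γ)) ⟩
  + 0 ∎
  where
  cancel : ∀ a → a + - + 1 * a ≡ + 0
  cancel = solve-∀

χ-orthogonal : {x y : 𝔽₂^ n} → x ≢ y → ∑[ z ∈ allVecs n ] (χ z x * χ z y) ≡ + 0
χ-orthogonal {n} {x} {y} x≢y =
  trans (∑-cong (allVecs n) (λ z → trans (sym (χ-⊕ʳ z x y)) (χ-comm z (x ⊕ y))))
        (∑-χ (x ⊕ y) (x≢y ∘ ⊕≡𝟘⇒≡ x y))

∑-χ-orthogonality : (h : 𝔽₂^ n → ℤ) (x : 𝔽₂^ n) →
  ∑[ y ∈ allVecs n ] (h y * (∑[ z ∈ allVecs n ] (χ z x * χ z y))) ≡ h x * (∑[ z ∈ allVecs n ] (+ 1))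
∑-χ-orthogonality {n} h x = begin
  ∑[ y ∈ allVecs n ] (h y * (∑[ z ∈ allVecs n ] (χ z x * χ z y)))
    ≡⟨ ∑-concentrated x (λ y y≢x → trans (cong (h y *_) (χ-orthogonal (y≢x ∘ sym))) (*-zeroʳ (h y))) ⟩
  h x * (∑[ z ∈ allVecs n ] (χ z x * χ z x))
    ≡⟨ cong (h x *_) (∑-cong (allVecs n) (λ z → sign-square (dot z x))) ⟩
  h x * (∑[ z ∈ allVecs n ] (+ 1)) ∎

double≡0⇒≡0 : {i : ℤ} → i + i ≡ + 0 → i ≡ + 0
double≡0⇒≡0 {i} i+i≡0 = [ (λ ()) , id ] (i*j≡0⇒i≡0∨j≡0 (+ 2) (trans (double i) i+i≡0))
  where
  double : ∀ a → + 2 * a ≡ a + a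
  double = solve-∀

module _ {f : 𝔽₂^ n → ℤ} (boolean : IsBoolean f) where

  private
    F : 𝔽₂^ n → ℤ
    F = scaledFourier f

  boolean-square : ∀ x → f x * f x ≡ + 1
  boolean-square x with boolean x
  ... | inj₁ fx≡1  rewrite fx≡1  = refl
  ... | inj₂ fx≡-1 rewrite fx≡-1 = refl

  autocorrelation : (γ : 𝔽₂^ n) → γ ≢ 𝟘 n → ∑[ z ∈ allVecs n ] (F z * F (z ⊕ γ)) ≡ + 0
  autocorrelation γ γ≢𝟘 = begin
    ∑[ z ∈ V ] (F z * F (z ⊕ γ))
      ≡⟨ ∑-cong V (λ z → ∑-*-∑ V V _ _) ⟩
    ∑[ z ∈ V ] ∑[ x ∈ V ] ∑[ y ∈ V ] ((f x * χ z x) * (f y * χ (z ⊕ γ) y))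
      ≡⟨ ∑-cong V (λ z → ∑-cong V (λ x → ∑-cong V (λ y → regroup z x y))) ⟩
    ∑[ z ∈ V ] ∑[ x ∈ V ] ∑[ y ∈ V ] (K x y * (χ z x * χ z y))
      ≡⟨ ∑-comm V V _ ⟩
    ∑[ x ∈ V ] ∑[ z ∈ V ] ∑[ y ∈ V ] (K x y * (χ z x * χ z y))
      ≡⟨ ∑-cong V (λ x → ∑-comm V V _) ⟩
    ∑[ x ∈ V ] ∑[ y ∈ V ] ∑[ z ∈ V ] (K x y * (χ z x * χ z y))
      ≡⟨ ∑-cong V (λ x → ∑-cong V (λ y → ∑-*ˡ V (K x y) _)) ⟩
    ∑[ x ∈ V ] ∑[ y ∈ V ] (K x y * (∑[ z ∈ V ] (χ z x * χ z y)))
      ≡⟨ ∑-cong V (λ x → ∑-χ-orthogonality (K x) x) ⟩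
    ∑[ x ∈ V ] (K x x * (∑[ z ∈ V ] (+ 1)))
      ≡⟨ ∑-*ʳ V _ (λ x → K x x) ⟩
    ∑[ x ∈ V ] K x x * (∑[ z ∈ V ] (+ 1))
      ≡⟨ cong (_* _) (trans (∑-cong V K-diagonal) (∑-χ γ γ≢𝟘)) ⟩
    + 0 ∎
    where
    V : List (𝔽₂^ n)
    V = allVecs n

    K : 𝔽₂^ n → 𝔽₂^ n → ℤ
    K x y = f x * f y * χ γ y

    regroup : ∀ z x y → (f x * χ z x) * (f y * χ (z ⊕ γ) y) ≡ K x y * (χ z x * χ z y)
    regroup z x y = trans (cong (λ t → (f x * χ z x) * (f y * t)) (χ-⊕ˡ z γ y))
                          (shuffle (f x) (χ z x) (f y) (χ z y) (χ γ y))
      where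
      shuffle : ∀ (a b c d e : ℤ) → (a * b) * (c * (d * e)) ≡ (a * c * e) * (b * d)
      shuffle = solve-∀

    K-diagonal : ∀ x → K x x ≡ χ γ x
    K-diagonal x = trans (cong (_* χ γ x) (boolean-square x)) (*-identityˡ (χ γ x))

  other-support-pair : {α β : 𝔽₂^ n} → InSupport f α → InSupport f β → α ≢ β →
    ∃[ z ] (InSupport f z × InSupport f (z ⊕ (α ⊕ β)) × z ≢ α × z ≢ β)
  other-support-pair {α} {β} α∈𝒮 β∈𝒮 α≢β =
    decidable-stable (∃?-𝔽₂^ P?) (Fα*Fβ≢0 ∘ double≡0⇒≡0 ∘ twice-Fα*Fβ≡0)
    where
    γ : 𝔽₂^ n
    γ = α ⊕ β

    T : 𝔽₂^ n → ℤ
    T z = F z * F (z ⊕ γ)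

    P : 𝔽₂^ n → Set
    P z = InSupport f z × InSupport f (z ⊕ γ) × z ≢ α × z ≢ β

    InSupport? : ∀ z → Dec (InSupport f z)
    InSupport? z = ¬? (F z ≟ℤ + 0)

    P? : ∀ z → Dec (P z)
    P? z = InSupport? z ×-dec InSupport? (z ⊕ γ) ×-dec ¬? (z ≟ᵛ α) ×-dec ¬? (z ≟ᵛ β)

    T-vanish : ¬ (∃[ z ] P z) → ∀ z → z ≢ α → z ≢ β → T z ≡ + 0
    T-vanish none z z≢α z≢β with F z ≟ℤ + 0 | F (z ⊕ γ) ≟ℤ + 0
    ... | yes Fz≡0 | _          = cong (_* F (z ⊕ γ)) Fz≡0
    ... | no  _    | yes Fz'≡0  = trans (cong (F z *_) Fz'≡0) (*-zeroʳ (F z))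
    ... | no  z∈𝒮  | no  z'∈𝒮   = contradiction (z , z∈𝒮 , z'∈𝒮 , z≢α , z≢β) none

    T-at-α : T α ≡ F α * F β
    T-at-α = cong (λ t → F α * F t) (⊕-cancelˡ α β)

    T-at-β : T β ≡ F α * F β
    T-at-β = trans (cong (λ t → F β * F t) (⊕-cancelʳ α β)) (*-comm (F β) (F α))

    twice-Fα*Fβ≡0 : ¬ (∃[ z ] P z) → F α * F β + F α * F β ≡ + 0
    twice-Fα*Fβ≡0 none = begin
      F α * F β + F α * F β ≡⟨ sym (cong₂ _+_ T-at-α T-at-β) ⟩
      T α + T β             ≡⟨ sym (∑-concentrated₂ α≢β (T-vanish none)) ⟩
      ∑ (allVecs n) T       ≡⟨ autocorrelation γ (α≢β ∘ ⊕≡𝟘⇒≡ α β) ⟩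
      + 0 ∎

    Fα*Fβ≢0 : F α * F β ≢ + 0
    Fα*Fβ≢0 = [ α∈𝒮 , β∈𝒮 ] ∘ i*j≡0⇒i≡0∨j≡0 (F α)

proposition1 : (n : ℕ) (f : 𝔽₂^ n → ℤ) → IsBoolean f →
    (α β : 𝔽₂^ n) → InSupport f α → InSupport f β → α ≢ β →
    ∃[ γ ] ∃[ δ ] (InSupport f γ × InSupport f δ × γ ≢ δ ×
      ¬ ((γ ≡ α × δ ≡ β) ⊎ (γ ≡ β × δ ≡ α)) ×
      (α ⊕ β) ≡ (γ ⊕ δ))
proposition1 n f boolean α β α∈𝒮 β∈𝒮 α≢β =
  let z , z∈𝒮 , z⊕γ∈𝒮 , z≢α , z≢β = other-support-pair boolean α∈𝒮 β∈𝒮 α≢β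
  in  z , z ⊕ (α ⊕ β) , z∈𝒮 , z⊕γ∈𝒮 ,
      α≢β ∘ ⊕≡𝟘⇒≡ α β ∘ ⊕-fixed⇒𝟘 z (α ⊕ β) ,
      (λ { (inj₁ (z≡α , _)) → z≢α z≡α ; (inj₂ (z≡β , _)) → z≢β z≡β }) ,
      sym (⊕-cancelˡ z (α ⊕ β))
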